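{- Let $G=(V,E)$ be a graph with $V=\{v_1,\dots,v_n\}$ and let $k$ be a positive integer. Let $G'$ be the graph with vertex set $Y\cup Z$, where $Y=\{y_1,\dots,y_n\}$ and $Z=\{z_1,\dots,z_n\}$ are disjoint, whose edges are: $y_iy_j$ for all $i\neq j$ (so $Y$ is a clique), and $z_iy_j$ whenever $v_j\in N[v_i]$ in $G$ (there are no edges inside $Z$). Then $G$ has an irredundant set of size $k$ if and only if $G'$ has a pair of perfectly matched sets of size $k$.
   Context: All graphs are finite, simple and undirected; $N[v]$ denotes the closed neighborhood of $v$. A set $I\subseteq V$ is irredundant in $G$ if every $v\in I$ has a private closed neighbor $p(v)\in V$, i.e. $p(v)=v$ or $p(v)$ is adjacent to $v$, and no other vertex of $I$ is adjacent to $p(v)$. In a graph, a pair $(A,B)$ is a pair of perfectly matched sets if $A$ and $B$ are disjoint vertex subsets, every vertex of $A$ has exactly one neighbor in $B$, and every vertex of $B$ has exactly one neighbor in $A$; its size is $|A|=|B|$. -}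

module Defs where

open import Data.Nat using (ℕ)
open import Data.Bool using (Bool; true; false; not; _∨_)
open import Data.Fin using (Fin; splitAt)
open import Data.Fin.Properties using (_≟_)
open import Data.Fin.Subset using (Subset; _∈_; _∉_; ∣_∣)
open import Data.Sum using (_⊎_; inj₁; inj₂)
open import Data.Product using (Σ; ∃; _×_; _,_)
open import Relation.Nullary using (¬_; ⌊_⌋)
open import Relation.Binary.PropositionalEquality using (_≡_; _≢_)

record Graph (n : ℕ) : Set where
  field
    adj    : Fin n → Fin n → Bool
    sym    : ∀ u v → adj u v ≡ adj v u
    irrefl : ∀ v → adj v v ≡ false
open Graph public

Adjacent : ∀ {m} → (Fin m → Fin m → Bool) → Fin m → Fin m → Set
Adjacent a u v = a u v ≡ true

-- u ∈ N[v] : u = v or u adjacent to v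
InClosedNbr : ∀ {m} → (Fin m → Fin m → Bool) → Fin m → Fin m → Set
InClosedNbr a u v = u ≡ v ⊎ Adjacent a v u

Irredundant : ∀ {m} → (Fin m → Fin m → Bool) → Subset m → Set
Irredundant a I =
  ∀ v → v ∈ I →
    Σ (Fin _) λ p → InClosedNbr a p v ×
      (∀ w → w ∈ I → w ≢ v → ¬ InClosedNbr a p w)

ExactlyOneNbrIn : ∀ {m} → (Fin m → Fin m → Bool) → Subset m → Subset m → Set
ExactlyOneNbrIn a A B =
  ∀ x → x ∈ A →
    Σ (Fin _) λ y → (y ∈ B × Adjacent a x y) ×
      (∀ y' → y' ∈ B → Adjacent a x y' → y' ≡ y)

PerfectlyMatched : ∀ {m} → (Fin m → Fin m → Bool) → Subset m → Subset m → Set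
PerfectlyMatched a A B =
  (∀ x → x ∈ A → x ∉ B) × ExactlyOneNbrIn a A B × ExactlyOneNbrIn a B A

closedNbrᵇ : ∀ {n} → Graph n → Fin n → Fin n → Bool
closedNbrᵇ G i j = ⌊ j ≟ i ⌋ ∨ adj G i j

-- Adjacency of G' on the split vertex set: inj₁ i = y_i, inj₂ i = z_i
adj'⊎ : ∀ {n} → Graph n → Fin n ⊎ Fin n → Fin n ⊎ Fin n → Bool
adj'⊎ G (inj₁ i) (inj₁ j) = not ⌊ i ≟ j ⌋
adj'⊎ G (inj₂ i) (inj₁ j) = closedNbrᵇ G i j
adj'⊎ G (inj₁ j) (inj₂ i) = closedNbrᵇ G i j
adj'⊎ G (inj₂ i) (inj₂ j) = false

-- G' on vertex set Fin (n + n): the first n vertices are y_1..y_n,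
-- the last n are z_1..z_n (via splitAt).
adj' : ∀ {n} → Graph n → Fin (n Data.Nat.+ n) → Fin (n Data.Nat.+ n) → Bool
adj' {n} G u v = adj'⊎ G (splitAt n u) (splitAt n v)

module Submission where

-- An irredundant set I with private neighbours p(v) yields the pair
-- ({y_v : v ∈ I}, {z_p(v) : v ∈ I}): y_v z_q is an edge iff q ∈ N[v], and
-- privacy of p(v) says that z_p(v) sees no other y_w with w ∈ I.
-- Conversely, let (A, B) be perfectly matched in G'. The Z-vertices lie on
-- one side only: if z_c ∈ A and z_d ∈ B, their partners y_b ∈ B and y_a ∈ A
-- are adjacent, so y_b would have the two neighbours z_c and y_a in A.
-- Say A ⊆ Y. If B meets Y in y_b, then y_b is adjacent to every vertex of A,
-- so |A| = 1 and any single vertex of G is irredundant. Otherwise B ⊆ Z, and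
-- the partner z_p of y_v ∈ A is a private neighbour p of v in G.

open import Defs hiding (sym)
open import Data.Nat using (ℕ; suc; _<_; _≤_; _+_)
open import Data.Nat.Properties using (≤-antisym)
open import Data.Bool using (Bool; true; not)
open import Data.Fin using (Fin; zero; suc; splitAt; _↑ˡ_; _↑ʳ_)
open import Data.Fin.Properties
  using (_≟_; any?; suc-injective; ↑ˡ-injective; ↑ʳ-injective;
         splitAt-↑ˡ; splitAt-↑ʳ; splitAt⁻¹-↑ˡ; splitAt⁻¹-↑ʳ)
open import Data.Fin.Subset using (Subset; _∈_; _∉_; _∪_; ∣_∣; ⊥; ⁅_⁆; inside; outside)
open import Data.Fin.Subset.Properties
  using (_∈?_; ∉⊥; x∈⁅x⁆; x∈⁅y⁆⇒x≡y; x∈p∪q⁺; x∈p∪q⁻; ∪-identityˡ;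
         ⊆-antisym; ∣⊥∣≡0; ∣⁅x⁆∣≡1; p⊆q⇒∣p∣≤∣q∣)
open import Data.Vec using ([]; _∷_; here; there; lookup; tabulate)
open import Data.Vec.Properties using (lookup∘tabulate; []=⇒lookup; lookup⇒[]=)
open import Data.Sum using (_⊎_; inj₁; inj₂)
open import Data.Product using (Σ; ∃; _×_; _,_; proj₁; proj₂)
open import Data.Empty using (⊥-elim)
open import Function using (_∘_; Injective)
open import Relation.Nullary using (¬_; yes; no)
open import Relation.Nullary.Decidable using (isYes≗does; dec-false)
open import Relation.Binary.PropositionalEquality
  using (_≡_; _≢_; refl; sym; trans; cong; cong₂; subst)

InjectiveOn : ∀ {m n} → (Fin m → Fin n) → Subset m → Set
InjectiveOn f p = ∀ {x x′} → x ∈ p → x′ ∈ p → f x ≡ f x′ → x ≡ x′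

InjectiveOn-∷ : ∀ {m n} {f : Fin (suc m) → Fin n} {s p} →
                InjectiveOn f (s ∷ p) → InjectiveOn (f ∘ suc) p
InjectiveOn-∷ inj x∈p x′∈p fx≡fx′ = suc-injective (inj (there x∈p) (there x′∈p) fx≡fx′)

image : ∀ {m n} → (Fin m → Fin n) → Subset m → Subset n
image f []            = ⊥
image f (outside ∷ p) = image (f ∘ suc) p
image f (inside  ∷ p) = ⁅ f zero ⁆ ∪ image (f ∘ suc) p

∈-image⁺ : ∀ {m n} (f : Fin m → Fin n) {p x} → x ∈ p → f x ∈ image f p
∈-image⁺ f {inside  ∷ p} here        = x∈p∪q⁺ (inj₁ (x∈⁅x⁆ (f zero)))
∈-image⁺ f {outside ∷ p} (there x∈p) = ∈-image⁺ (f ∘ suc) x∈p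
∈-image⁺ f {inside  ∷ p} (there x∈p) = x∈p∪q⁺ (inj₂ (∈-image⁺ (f ∘ suc) x∈p))

∈-image⁻ : ∀ {m n} (f : Fin m → Fin n) p {y} → y ∈ image f p → ∃ λ x → x ∈ p × f x ≡ y
∈-image⁻ f []            y∈ = ⊥-elim (∉⊥ y∈)
∈-image⁻ f (outside ∷ p) y∈ with ∈-image⁻ (f ∘ suc) p y∈
... | x , x∈p , fx≡y = suc x , there x∈p , fx≡y
∈-image⁻ f (inside ∷ p)  y∈ with x∈p∪q⁻ ⁅ f zero ⁆ (image (f ∘ suc) p) y∈
... | inj₁ y∈⁅f0⁆ = zero , here , sym (x∈⁅y⁆⇒x≡y (f zero) y∈⁅f0⁆)
... | inj₂ y∈img with ∈-image⁻ (f ∘ suc) p y∈img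
...   | x , x∈p , fx≡y = suc x , there x∈p , fx≡y

∣⁅x⁆∪p∣≡1+∣p∣ : ∀ {n} {x : Fin n} {p} → x ∉ p → ∣ ⁅ x ⁆ ∪ p ∣ ≡ suc ∣ p ∣
∣⁅x⁆∪p∣≡1+∣p∣ {x = zero}  {outside ∷ p} _   = cong suc (cong ∣_∣ (∪-identityˡ p))
∣⁅x⁆∪p∣≡1+∣p∣ {x = zero}  {inside  ∷ p} x∉p = ⊥-elim (x∉p here)
∣⁅x⁆∪p∣≡1+∣p∣ {x = suc x} {outside ∷ p} x∉p = ∣⁅x⁆∪p∣≡1+∣p∣ (x∉p ∘ there)
∣⁅x⁆∪p∣≡1+∣p∣ {x = suc x} {inside  ∷ p} x∉p = cong suc (∣⁅x⁆∪p∣≡1+∣p∣ (x∉p ∘ there))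

∣image∣ : ∀ {m n} (f : Fin m → Fin n) p → InjectiveOn f p → ∣ image f p ∣ ≡ ∣ p ∣
∣image∣ {n = n} f []  _   = ∣⊥∣≡0 n
∣image∣ f (outside ∷ p) inj = ∣image∣ (f ∘ suc) p (InjectiveOn-∷ inj)
∣image∣ f (inside  ∷ p) inj =
  trans (∣⁅x⁆∪p∣≡1+∣p∣ f0∉img) (cong suc (∣image∣ (f ∘ suc) p (InjectiveOn-∷ inj)))
  where
  f0∉img : f zero ∉ image (f ∘ suc) p
  f0∉img f0∈img with ∈-image⁻ (f ∘ suc) p f0∈img
  ... | x , x∈p , fx≡f0 with inj (there x∈p) here fx≡f0
  ...   | ()

preimage : ∀ {m n} → (Fin m → Fin n) → Subset n → Subset m
preimage f p = tabulate (lookup p ∘ f)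

∈-preimage⁺ : ∀ {m n} {f : Fin m → Fin n} {p i} → f i ∈ p → i ∈ preimage f p
∈-preimage⁺ {f = f} {p} {i} fi∈p =
  lookup⇒[]= i _ (trans (lookup∘tabulate (lookup p ∘ f) i) ([]=⇒lookup fi∈p))

∈-preimage⁻ : ∀ {m n} {f : Fin m → Fin n} {p i} → i ∈ preimage f p → f i ∈ p
∈-preimage⁻ {f = f} {p} {i} i∈ =
  lookup⇒[]= (f i) p (trans (sym (lookup∘tabulate (lookup p ∘ f) i)) ([]=⇒lookup i∈))

image-preimage : ∀ {m n} {f : Fin m → Fin n} {p} →
                 (∀ {x} → x ∈ p → ∃ λ i → f i ≡ x) → image f (preimage f p) ≡ p
image-preimage {f = f} {p} cover = ⊆-antisym image⊆p p⊆image
  where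
  image⊆p : ∀ {x} → x ∈ image f (preimage f p) → x ∈ p
  image⊆p x∈ with ∈-image⁻ f (preimage f p) x∈
  ... | i , i∈ , refl = ∈-preimage⁻ i∈

  p⊆image : ∀ {x} → x ∈ p → x ∈ image f (preimage f p)
  p⊆image x∈p with cover x∈p
  ... | i , refl = ∈-image⁺ f (∈-preimage⁺ x∈p)

∣preimage∣ : ∀ {m n} {f : Fin m → Fin n} {p} → Injective _≡_ _≡_ f →
             (∀ {x} → x ∈ p → ∃ λ i → f i ≡ x) → ∣ preimage f p ∣ ≡ ∣ p ∣
∣preimage∣ {f = f} {p} inj cover =
  trans (sym (∣image∣ f (preimage f p) (λ _ _ → inj))) (cong ∣_∣ (image-preimage cover))

module _ {m} {a : Fin m → Fin m → Bool} where

  IsPrivateNbr : Subset m → Fin m → Fin m → Set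
  IsPrivateNbr I v p = InClosedNbr a p v × (∀ w → w ∈ I → w ≢ v → ¬ InClosedNbr a p w)

  privateNbr-owner : ∀ {I v p w} → IsPrivateNbr I v p → w ∈ I → InClosedNbr a p w → w ≡ v
  privateNbr-owner {v = v} {w = w} (_ , exclusive) w∈I p∈N[w] with w ≟ v
  ... | yes w≡v = w≡v
  ... | no  w≢v = ⊥-elim (exclusive w w∈I w≢v p∈N[w])

  privateNbr-function : ∀ {I} → Irredundant a I →
                        Σ (Fin m → Fin m) λ p → ∀ v → v ∈ I → IsPrivateNbr I v (p v)
  privateNbr-function {I} irr = p , isPrivate
    where
    p : Fin m → Fin m
    p v with v ∈? I
    ... | yes v∈I = proj₁ (irr v v∈I)
    ... | no  _   = v

    isPrivate : ∀ v → v ∈ I → IsPrivateNbr I v (p v)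
    isPrivate v v∈I with v ∈? I
    ... | yes v∈I′ = proj₂ (irr v v∈I′)
    ... | no  v∉I  = ⊥-elim (v∉I v∈I)

  ⁅⁆-irredundant : ∀ u → Irredundant a ⁅ u ⁆
  ⁅⁆-irredundant u v v∈⁅u⁆ = v , inj₁ refl , λ w w∈⁅u⁆ w≢v _ →
    w≢v (trans (x∈⁅y⁆⇒x≡y u w∈⁅u⁆) (sym (x∈⁅y⁆⇒x≡y u v∈⁅u⁆)))

  ExactlyOneNbrIn-unique : ∀ {A B x t t′} → ExactlyOneNbrIn a A B → x ∈ A →
                           t ∈ B → t′ ∈ B → Adjacent a x t → Adjacent a x t′ → t ≡ t′
  ExactlyOneNbrIn-unique A→B x∈A t∈B t′∈B x∼t x∼t′ =
    let unique = proj₂ (proj₂ (A→B _ x∈A))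
    in trans (unique _ t∈B x∼t) (sym (unique _ t′∈B x∼t′))

  PerfectlyMatched-swap : ∀ {A B} → PerfectlyMatched a A B → PerfectlyMatched a B A
  PerfectlyMatched-swap (disjoint , A→B , B→A) = (λ x x∈B x∈A → disjoint x x∈A x∈B) , B→A , A→B

HasIrredundantSet : ∀ {m} → (Fin m → Fin m → Bool) → ℕ → Set
HasIrredundantSet {m} a k = Σ (Subset m) λ I → Irredundant a I × ∣ I ∣ ≡ k

HasPerfectlyMatchedPair : ∀ {m} → (Fin m → Fin m → Bool) → ℕ → Set
HasPerfectlyMatchedPair {m} a k =
  Σ (Subset m) λ A → Σ (Subset m) λ B → PerfectlyMatched a A B × ∣ A ∣ ≡ k × ∣ B ∣ ≡ k

module _ {n} (G : Graph n) where

  y z : Fin n → Fin (n + n)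
  y i = i ↑ˡ n
  z i = n ↑ʳ i

  splitAt-y : ∀ i → splitAt n (y i) ≡ inj₁ i
  splitAt-y i = splitAt-↑ˡ n i n

  splitAt-z : ∀ i → splitAt n (z i) ≡ inj₂ i
  splitAt-z i = splitAt-↑ʳ n n i

  y≢z : ∀ {i j} → y i ≢ z j
  y≢z {i} {j} yi≡zj with trans (sym (splitAt-y i)) (trans (cong (splitAt n) yi≡zj) (splitAt-z j))
  ... | ()

  data YZ : Fin (n + n) → Set where
    isY : (i : Fin n) → YZ (y i)
    isZ : (i : Fin n) → YZ (z i)

  yz : (x : Fin (n + n)) → YZ x
  yz x with splitAt n x in eq
  ... | inj₁ i = subst YZ (splitAt⁻¹-↑ˡ eq) (isY i)
  ... | inj₂ i = subst YZ (splitAt⁻¹-↑ʳ eq) (isZ i)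

  private
    infix 4 _∼_
    _∼_ : Fin (n + n) → Fin (n + n) → Set
    _∼_ = Adjacent (adj' G)

  -- closedNbrᵇ G p v tests v ∈ N[p]; symmetry of G turns it into p ∈ N[v].
  closedNbrᵇ⁺ : ∀ {p v} → InClosedNbr (adj G) p v → closedNbrᵇ G p v ≡ true
  closedNbrᵇ⁺ {p} {v} p∈N[v] with v ≟ p | p∈N[v]
  ... | yes _   | _        = refl
  ... | no  v≢p | inj₁ p≡v = ⊥-elim (v≢p (sym p≡v))
  ... | no  _   | inj₂ v∼p = trans (Graph.sym G p v) v∼p

  closedNbrᵇ⁻ : ∀ {p v} → closedNbrᵇ G p v ≡ true → InClosedNbr (adj G) p v
  closedNbrᵇ⁻ {p} {v} b with v ≟ p
  ... | yes v≡p = inj₁ (sym v≡p)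
  ... | no  _   = inj₂ (trans (Graph.sym G v p) b)

  y∼y : ∀ {i j} → i ≢ j → y i ∼ y j
  y∼y {i} {j} i≢j = trans (cong₂ (adj'⊎ G) (splitAt-y i) (splitAt-y j))
                          (cong not (trans (isYes≗does (i ≟ j)) (dec-false (i ≟ j) i≢j)))

  z≁z : ∀ {i j} → ¬ z i ∼ z j
  z≁z {i} {j} zi∼zj with trans (sym (cong₂ (adj'⊎ G) (splitAt-z i) (splitAt-z j))) zi∼zj
  ... | ()

  adj'-y-z : ∀ v p → adj' G (y v) (z p) ≡ closedNbrᵇ G p v
  adj'-y-z v p = cong₂ (adj'⊎ G) (splitAt-y v) (splitAt-z p)

  adj'-z-y : ∀ p v → adj' G (z p) (y v) ≡ closedNbrᵇ G p v
  adj'-z-y p v = cong₂ (adj'⊎ G) (splitAt-z p) (splitAt-y v)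

  y∼z⁺ : ∀ {v p} → InClosedNbr (adj G) p v → y v ∼ z p
  y∼z⁺ {v} {p} p∈N[v] = trans (adj'-y-z v p) (closedNbrᵇ⁺ p∈N[v])

  y∼z⁻ : ∀ {v p} → y v ∼ z p → InClosedNbr (adj G) p v
  y∼z⁻ {v} {p} yv∼zp = closedNbrᵇ⁻ (trans (sym (adj'-y-z v p)) yv∼zp)

  z∼y⁺ : ∀ {p v} → InClosedNbr (adj G) p v → z p ∼ y v
  z∼y⁺ {p} {v} p∈N[v] = trans (adj'-z-y p v) (closedNbrᵇ⁺ p∈N[v])

  z∼y⁻ : ∀ {p v} → z p ∼ y v → InClosedNbr (adj G) p v
  z∼y⁻ {p} {v} zp∼yv = closedNbrᵇ⁻ (trans (sym (adj'-z-y p v)) zp∼yv)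

  irredundant⇒perfectlyMatched : ∀ {k} → HasIrredundantSet (adj G) k → HasPerfectlyMatchedPair (adj' G) k
  irredundant⇒perfectlyMatched (I , irr , ∣I∣≡k) =
    A , B , (disjoint , A→B , B→A) ,
    trans (∣image∣ y I y-injective) ∣I∣≡k , trans (∣image∣ (z ∘ p) I zp-injective) ∣I∣≡k
    where
    p : Fin n → Fin n
    p = proj₁ (privateNbr-function irr)

    p-private : ∀ v → v ∈ I → IsPrivateNbr {a = adj G} I v (p v)
    p-private = proj₂ (privateNbr-function irr)

    p-owner : ∀ {v w} → w ∈ I → v ∈ I → InClosedNbr (adj G) (p w) v → v ≡ w
    p-owner {w = w} w∈I = privateNbr-owner {a = adj G} (p-private w w∈I)

    A B : Subset (n + n)
    A = image y I
    B = image (z ∘ p) I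

    y-injective : InjectiveOn y I
    y-injective _ _ = ↑ˡ-injective n _ _

    zp-injective : InjectiveOn (z ∘ p) I
    zp-injective {v} {w} v∈I w∈I zpv≡zpw =
      let pv≡pw = ↑ʳ-injective n (p v) (p w) zpv≡zpw
      in p-owner w∈I v∈I (subst (λ q → InClosedNbr (adj G) q v) pv≡pw (proj₁ (p-private v v∈I)))

    disjoint : ∀ x → x ∈ A → x ∉ B
    disjoint x x∈A x∈B with ∈-image⁻ y I x∈A
    ... | v , _ , refl with ∈-image⁻ (z ∘ p) I x∈B
    ...   | _ , _ , zpw≡yv = y≢z (sym zpw≡yv)

    A→B : ExactlyOneNbrIn (adj' G) A B
    A→B x x∈A with ∈-image⁻ y I x∈A
    ... | v , v∈I , refl =
      z (p v) , (∈-image⁺ (z ∘ p) v∈I , y∼z⁺ (proj₁ (p-private v v∈I))) , unique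
      where
      unique : ∀ t → t ∈ B → y v ∼ t → t ≡ z (p v)
      unique t t∈B yv∼t with ∈-image⁻ (z ∘ p) I t∈B
      ... | w , w∈I , refl = cong (z ∘ p) (sym (p-owner w∈I v∈I (y∼z⁻ yv∼t)))

    B→A : ExactlyOneNbrIn (adj' G) B A
    B→A x x∈B with ∈-image⁻ (z ∘ p) I x∈B
    ... | w , w∈I , refl =
      y w , (∈-image⁺ y w∈I , z∼y⁺ (proj₁ (p-private w w∈I))) , unique
      where
      unique : ∀ t → t ∈ A → z (p w) ∼ t → t ≡ y w
      unique t t∈A zpw∼t with ∈-image⁻ y I t∈A
      ... | v , v∈I , refl = cong y (p-owner w∈I v∈I (z∼y⁻ zpw∼t))

  z-partner : ∀ {A B c} → ExactlyOneNbrIn (adj' G) A B → z c ∈ A →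
              ∃ λ b → y b ∈ B × InClosedNbr (adj G) c b
  z-partner {c = c} A→B zc∈A with A→B (z c) zc∈A
  ... | t , (t∈B , zc∼t) , _ with yz t
  ...   | isY b = b , t∈B , z∼y⁻ zc∼t
  ...   | isZ _ = ⊥-elim (z≁z zc∼t)

  z-free-side : ∀ {A B} → PerfectlyMatched (adj' G) A B → (∀ c → z c ∉ A) ⊎ (∀ c → z c ∉ B)
  z-free-side {A} {B} (disjoint , A→B , B→A) with any? (λ c → z c ∈? A)
  ... | no  ∄c         = inj₁ (λ c zc∈A → ∄c (c , zc∈A))
  ... | yes (c , zc∈A) = inj₂ zd∉B
    where
    zd∉B : ∀ d → z d ∉ B
    zd∉B d zd∈B with z-partner A→B zc∈A | z-partner B→A zd∈B
    ... | b , yb∈B , c∈N[b] | a , ya∈A , _ = y≢z (sym zc≡ya)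
      where
      b≢a : b ≢ a
      b≢a refl = disjoint (y a) ya∈A yb∈B
      -- y b sees both z c and y a in A, since Y is a clique.
      zc≡ya : z c ≡ y a
      zc≡ya = ExactlyOneNbrIn-unique B→A yb∈B zc∈A ya∈A (y∼z⁺ c∈N[b]) (y∼y b≢a)

  Y-side-≤1 : ∀ {A B b} → PerfectlyMatched (adj' G) A B → (∀ c → z c ∉ A) → y b ∈ B →
              ∣ A ∣ ≤ 1
  Y-side-≤1 {A} {B} {b} (disjoint , _ , B→A) z∉A yb∈B with B→A (y b) yb∈B
  ... | t , _ , unique = subst (∣ A ∣ ≤_) (∣⁅x⁆∣≡1 t) (p⊆q⇒∣p∣≤∣q∣ A⊆⁅t⁆)
    where
    A⊆⁅t⁆ : ∀ {x} → x ∈ A → x ∈ ⁅ t ⁆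
    A⊆⁅t⁆ {x} x∈A with yz x
    ... | isZ c = ⊥-elim (z∉A c x∈A)
    ... | isY i = subst (_∈ ⁅ t ⁆) (sym (unique (y i) x∈A (y∼y b≢i))) (x∈⁅x⁆ t)
      where
      b≢i : b ≢ i
      b≢i refl = disjoint (y b) x∈A yb∈B

  preimage-y-irredundant : ∀ {A B} → PerfectlyMatched (adj' G) A B → (∀ c → y c ∉ B) →
                           Irredundant (adj G) (preimage y A)
  preimage-y-irredundant {A} (_ , A→B , B→A) y∉B v v∈I with A→B (y v) (∈-preimage⁻ v∈I)
  ... | t , (t∈B , yv∼t) , _ with yz t
  ...   | isY c = ⊥-elim (y∉B c t∈B)
  ...   | isZ p = p , p∈N[v] , exclusive
    where
    p∈N[v] : InClosedNbr (adj G) p v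
    p∈N[v] = y∼z⁻ yv∼t

    exclusive : ∀ w → w ∈ preimage y A → w ≢ v → ¬ InClosedNbr (adj G) p w
    exclusive w w∈I w≢v p∈N[w] = w≢v (↑ˡ-injective n w v (ExactlyOneNbrIn-unique B→A t∈B
      (∈-preimage⁻ w∈I) (∈-preimage⁻ v∈I) (z∼y⁺ p∈N[w]) (z∼y⁺ p∈N[v])))

  Y-side-perfectlyMatched⇒irredundant : ∀ {A B k} → 0 < k → PerfectlyMatched (adj' G) A B →
                                        (∀ c → z c ∉ A) → ∣ A ∣ ≡ k → HasIrredundantSet (adj G) k
  Y-side-perfectlyMatched⇒irredundant {A} {B} {k} 0<k pm z∉A ∣A∣≡k with any? (λ b → y b ∈? B)
  ... | yes (b , yb∈B) = ⁅ b ⁆ , ⁅⁆-irredundant b , trans (∣⁅x⁆∣≡1 b) (sym k≡1)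
    where
    k≡1 : k ≡ 1
    k≡1 = ≤-antisym (subst (_≤ 1) ∣A∣≡k (Y-side-≤1 pm z∉A yb∈B)) 0<k
  ... | no ∄b = preimage y A , preimage-y-irredundant pm (λ c yc∈B → ∄b (c , yc∈B)) ,
                trans (∣preimage∣ (↑ˡ-injective n _ _) A⊆Y) ∣A∣≡k
    where
    A⊆Y : ∀ {x} → x ∈ A → ∃ λ i → y i ≡ x
    A⊆Y {x} x∈A with yz x
    ... | isY i = i , refl
    ... | isZ c = ⊥-elim (z∉A c x∈A)

  perfectlyMatched⇒irredundant : ∀ {k} → 0 < k →
                                 HasPerfectlyMatchedPair (adj' G) k → HasIrredundantSet (adj G) k
  perfectlyMatched⇒irredundant 0<k (A , B , pm , ∣A∣≡k , ∣B∣≡k) with z-free-side pm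
  ... | inj₁ z∉A = Y-side-perfectlyMatched⇒irredundant 0<k pm z∉A ∣A∣≡k
  ... | inj₂ z∉B = Y-side-perfectlyMatched⇒irredundant 0<k (PerfectlyMatched-swap pm) z∉B ∣B∣≡k

proposition1 : ∀ (n : ℕ) (G : Graph n) (k : ℕ) → 0 < k →
    (Σ (Subset n) (λ I → Irredundant (adj G) I × ∣ I ∣ ≡ k) →
      Σ (Subset (n + n)) (λ A → Σ (Subset (n + n)) (λ B →
        PerfectlyMatched (adj' G) A B × ∣ A ∣ ≡ k × ∣ B ∣ ≡ k)))
    × (Σ (Subset (n + n)) (λ A → Σ (Subset (n + n)) (λ B →
        PerfectlyMatched (adj' G) A B × ∣ A ∣ ≡ k × ∣ B ∣ ≡ k)) →
      Σ (Subset n) (λ I → Irredundant (adj G) I × ∣ I ∣ ≡ k))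
proposition1 n G k 0<k = irredundant⇒perfectlyMatched G , perfectlyMatched⇒irredundant G 0<k
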